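{- For every graph $G$, ${\rm ivs_{\chi}}(G)$ equals the minimum size of a colour class over all proper $\chi(G)$-colourings of $G$. Consequently $|V(G)|\ge {\rm ivs_{\chi}}(G)\cdot \chi(G)$.
   Context: All graphs are finite and simple; $\chi(G)$ is the chromatic number. The independent chromatic vertex stability ${\rm ivs_{\chi}}(G)$ is the minimum size of an independent set $S\subseteq V(G)$ such that $\chi(G-S)=\chi(G)-1$. -}

module Defs where

open import Level using (0ℓ)
open import Data.Nat using (ℕ; suc; _≤_; _<_; _∸_)
open import Data.Fin using (Fin)
open import Data.Fin.Properties using () renaming (_≟_ to _≟F_)
open import Data.Fin.Subset using (Subset; _∈_; _∉_; ∣_∣)
open import Data.Vec using (tabulate)
open import Data.Product using (Σ; ∃; ∃-syntax; _×_; _,_; proj₁)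
open import Relation.Nullary using (¬_)
open import Relation.Nullary.Decidable using (⌊_⌋)
open import Relation.Binary.PropositionalEquality using (_≡_; _≢_)

record Graph (V : Set) : Set₁ where
  field
    Adj    : V → V → Set
    sym    : ∀ {u v} → Adj u v → Adj v u
    irrefl : ∀ {v} → ¬ Adj v v
open Graph public

FinGraph : ℕ → Set₁
FinGraph n = Graph (Fin n)

IsProper : ∀ {V} (G : Graph V) {k : ℕ} → (V → Fin k) → Set
IsProper G c = ∀ u v → Adj G u v → c u ≢ c v

Colourable : ∀ {V} → Graph V → ℕ → Set
Colourable {V} G k = Σ (V → Fin k) (IsProper G)

IsChromaticNumber : ∀ {V} → Graph V → ℕ → Set
IsChromaticNumber G k = Colourable G k × (∀ m → m < k → ¬ Colourable G m)

delete : ∀ {n} → FinGraph n → (S : Subset n) → Graph (Σ (Fin n) (λ v → v ∉ S))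
delete G S = record
  { Adj    = λ u v → Adj G (proj₁ u) (proj₁ v)
  ; sym    = sym G
  ; irrefl = irrefl G
  }

Independent : ∀ {n} → FinGraph n → Subset n → Set
Independent G S = ∀ u v → u ∈ S → v ∈ S → ¬ Adj G u v

IsIVSSet : ∀ {n} → FinGraph n → (k : ℕ) → Subset n → Set
IsIVSSet G k S = Independent G S × IsChromaticNumber (delete G S) (k ∸ 1)

IsIvs : ∀ {n} → FinGraph n → (k s : ℕ) → Set
IsIvs G k s =
  (∃[ S ] (IsIVSSet G k S × ∣ S ∣ ≡ s)) × (∀ S → IsIVSSet G k S → s ≤ ∣ S ∣)

colourClass : ∀ {n k} → (Fin n → Fin k) → Fin k → Subset n
colourClass c i = tabulate (λ v → ⌊ c v ≟F i ⌋)

IsMinClassSize : ∀ {n} → FinGraph n → (k s : ℕ) → Set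
IsMinClassSize {n} G k s =
  (Σ (Fin n → Fin k) λ c → IsProper G c × ∃[ i ] (∣ colourClass c i ∣ ≡ s))
  × ((c : Fin n → Fin k) → IsProper G c → ∀ i → s ≤ ∣ colourClass c i ∣)

{-# OPTIONS --safe #-}
-- Proof idea: the sets S achieving ivs_χ(G) are exactly the colour classes of proper
-- χ(G)-colourings. A colour class is independent and deleting it leaves χ(G) - 1 colours;
-- conversely, colouring G - S with χ(G) - 1 colours and giving S one new colour yields a proper
-- χ(G)-colouring with S as a class. The bound follows because the χ(G) classes of a minimising
-- colouring partition V(G) and each has at least ivs_χ(G) vertices.
module Submission where

open import Defs hiding (sym)
open import Data.Nat using (ℕ; zero; suc; _+_; _*_; _≤_; _<_; z≤n; s≤s)
open import Data.Nat.Properties using (+-mono-≤; *-comm; +-0-commutativeMonoid)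
open import Data.Product using (_×_; Σ; _,_; proj₁)
open import Function.Base using (_∘_)
open import Function.Bundles using (_⇔_; mk⇔; Equivalence)
open import Data.Bool using (true; false)
open import Data.Bool.Properties using (T-≡)
open import Data.Fin using (Fin; zero; suc; fromℕ; inject₁; punchIn; punchOut)
open import Data.Fin.Properties
  using (fromℕ≢inject₁; inject₁-injective; punchOut-injective; punchInᵢ≢i)
  renaming (_≟_ to _≟F_)
open import Data.Fin.Subset using (Subset; _∈_; _∉_; ∣_∣)
open import Data.Fin.Subset.Properties using (_∈?_; ⊆-antisym)
open import Data.Vec using (_∷_; lookup)
open import Data.Vec.Functional using (removeAt)
open import Data.Vec.Properties using ([]=⇒lookup; lookup⇒[]=; lookup∘tabulate)
open import Algebra.Properties.CommutativeMonoid.Sum +-0-commutativeMonoid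
  using (sum; sum-cong-≗; sum-remove; sum-replicate-zero)
open import Relation.Nullary using (¬_; yes; no; contradiction)
open import Relation.Nullary.Decidable
  using (Dec; ⌊_⌋; toWitness; dec-true; dec-false; isYes≗does)
open import Relation.Binary.PropositionalEquality

⌊⌋-true : ∀ {a} {A : Set a} (a? : Dec A) → A → ⌊ a? ⌋ ≡ true
⌊⌋-true a? a = trans (isYes≗does a?) (dec-true a? a)

⌊⌋-false : ∀ {a} {A : Set a} (a? : Dec A) → ¬ A → ⌊ a? ⌋ ≡ false
⌊⌋-false a? ¬a = trans (isYes≗does a?) (dec-false a? ¬a)

lookup-colourClass : ∀ {n k} (c : Fin n → Fin k) i v → lookup (colourClass c i) v ≡ ⌊ c v ≟F i ⌋
lookup-colourClass c i v = lookup∘tabulate _ v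

∈-colourClass⁻ : ∀ {n k} (c : Fin n → Fin k) {i v} → v ∈ colourClass c i → c v ≡ i
∈-colourClass⁻ c {i} {v} v∈ =
  toWitness (Equivalence.from T-≡ (trans (sym (lookup-colourClass c i v)) ([]=⇒lookup v∈)))

∈-colourClass⁺ : ∀ {n k} (c : Fin n → Fin k) {i v} → c v ≡ i → v ∈ colourClass c i
∈-colourClass⁺ c {i} {v} cv≡i = lookup⇒[]= v _ (trans (lookup-colourClass c i v) (⌊⌋-true (c v ≟F i) cv≡i))

∑-∣colourClass∣ : ∀ {n k} (c : Fin n → Fin k) → sum (λ i → ∣ colourClass c i ∣) ≡ n
∑-∣colourClass∣ {zero}  {k}     c = sum-replicate-zero k
∑-∣colourClass∣ {suc n} {zero}  c with c zero
... | ()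
-- Removing vertex 0 shrinks only the class of its colour j, by one.
∑-∣colourClass∣ {suc n} {suc k} c = begin
  sum ∣class∣                          ≡⟨ sum-remove {i = j} ∣class∣ ⟩
  ∣class∣ j + sum (removeAt ∣class∣ j) ≡⟨ cong₂ _+_ ∣class∣-j (sum-cong-≗ ∣class∣-punchIn) ⟩
  suc (∣class′∣ j + sum (removeAt ∣class′∣ j)) ≡⟨ cong suc (sum-remove {i = j} ∣class′∣) ⟨
  suc (sum ∣class′∣)                   ≡⟨ cong suc (∑-∣colourClass∣ (c ∘ suc)) ⟩
  suc n                                ∎
  where
  open ≡-Reasoning
  j : Fin (suc k)
  j = c zero
  ∣class∣ ∣class′∣ : Fin (suc k) → ℕ
  ∣class∣ i = ∣ colourClass c i ∣
  ∣class′∣ i = ∣ colourClass (c ∘ suc) i ∣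

  ∣class∣-j : ∣class∣ j ≡ suc (∣class′∣ j)
  ∣class∣-j = cong (λ b → ∣ b ∷ colourClass (c ∘ suc) j ∣) (⌊⌋-true (j ≟F j) refl)

  ∣class∣-punchIn : ∀ l → ∣class∣ (punchIn j l) ≡ ∣class′∣ (punchIn j l)
  ∣class∣-punchIn l =
    cong (λ b → ∣ b ∷ colourClass (c ∘ suc) (punchIn j l) ∣) (⌊⌋-false (j ≟F punchIn j l) (punchInᵢ≢i j l ∘ sym))

*-≤-sum : ∀ {k s} (f : Fin k → ℕ) → (∀ i → s ≤ f i) → k * s ≤ sum f
*-≤-sum {zero}  f s≤f = z≤n
*-≤-sum {suc k} f s≤f = +-mono-≤ (s≤f zero) (*-≤-sum (f ∘ suc) (s≤f ∘ suc))

module _ {n} (G : FinGraph n) where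

  colourClass-independent : ∀ {k} {c : Fin n → Fin k} → IsProper G c → ∀ i → Independent G (colourClass c i)
  colourClass-independent {c = c} c-proper i u v u∈ v∈ u~v =
    c-proper u v u~v (trans (∈-colourClass⁻ c u∈) (sym (∈-colourClass⁻ c v∈)))

  -- The colour i is missing outside its class, so punching it out leaves k colours.
  deleteColourClass-colourable : ∀ {k} {c : Fin n → Fin (suc k)} → IsProper G c →
    ∀ i → Colourable (delete G (colourClass c i)) k
  deleteColourClass-colourable {c = c} c-proper i = d , d-proper
    where
    i≢c : ∀ (w : Σ (Fin n) (_∉ colourClass c i)) → i ≢ c (proj₁ w)
    i≢c (v , v∉) i≡cv = v∉ (∈-colourClass⁺ c (sym i≡cv))

    d : Σ (Fin n) (_∉ colourClass c i) → Fin _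
    d w = punchOut (i≢c w)

    d-proper : IsProper (delete G (colourClass c i)) d
    d-proper u v u~v du≡dv = c-proper (proj₁ u) (proj₁ v) u~v (punchOut-injective (i≢c u) (i≢c v) du≡dv)

  addColour : ∀ {m} (S : Subset n) → (Σ (Fin n) (_∉ S) → Fin m) → Fin n → Fin (suc m)
  addColour {m} S d v with v ∈? S
  ... | yes _   = fromℕ m
  ... | no v∉S = inject₁ (d (v , v∉S))

  addColour-proper : ∀ {m S} {d : Σ (Fin n) (_∉ S) → Fin m} →
    Independent G S → IsProper (delete G S) d → IsProper G (addColour S d)
  addColour-proper {S = S} S-indep d-proper u v u~v with u ∈? S | v ∈? S
  ... | yes u∈S | yes v∈S = λ _ → S-indep u v u∈S v∈S u~v
  ... | yes _   | no _    = fromℕ≢inject₁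
  ... | no _    | yes _   = fromℕ≢inject₁ ∘ sym
  ... | no u∉S  | no v∉S  = d-proper (u , u∉S) (v , v∉S) u~v ∘ inject₁-injective

  colourClass-addColour : ∀ {m} S (d : Σ (Fin n) (_∉ S) → Fin m) → colourClass (addColour S d) (fromℕ m) ≡ S
  colourClass-addColour {m} S d =
    ⊆-antisym (class⊆S ∘ ∈-colourClass⁻ (addColour S d)) (∈-colourClass⁺ (addColour S d) ∘ S⊆class)
    where
    class⊆S : ∀ {v} → addColour S d v ≡ fromℕ m → v ∈ S
    class⊆S {v} with v ∈? S
    ... | yes v∈S = λ _ → v∈S
    ... | no _    = λ e → contradiction (sym e) fromℕ≢inject₁

    S⊆class : ∀ {v} → v ∈ S → addColour S d v ≡ fromℕ m
    S⊆class {v} v∈S with v ∈? S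
    ... | yes _   = refl
    ... | no v∉S = contradiction v∈S v∉S

  colourClass-isIVSSet : ∀ {k} → IsChromaticNumber G (suc k) →
    ∀ {c : Fin n → Fin (suc k)} → IsProper G c → ∀ i → IsIVSSet G (suc k) (colourClass c i)
  colourClass-isIVSSet (_ , χ-minimal) c-proper i =
    class-independent , deleteColourClass-colourable c-proper i , deletion-minimal
    where
    class-independent : Independent G (colourClass _ i)
    class-independent = colourClass-independent c-proper i

    deletion-minimal : ∀ m → m < _ → ¬ Colourable (delete G (colourClass _ i)) m
    deletion-minimal m m<k (d , d-proper) =
      χ-minimal (suc m) (s≤s m<k) (addColour _ d , addColour-proper class-independent d-proper)

  isIVSSet⇒colourClass : ∀ {k S} → IsIVSSet G (suc k) S →
    Σ (Fin n → Fin (suc k)) λ c → IsProper G c × colourClass c (fromℕ k) ≡ S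
  isIVSSet⇒colourClass {S = S} (S-independent , (d , d-proper) , _) =
    addColour S d , addColour-proper S-independent d-proper , colourClass-addColour S d

  isIvs⇔isMinClassSize : ∀ {k} → IsChromaticNumber G (suc k) →
    ∀ s → IsIvs G (suc k) s ⇔ IsMinClassSize G (suc k) s
  isIvs⇔isMinClassSize {k} χ s = mk⇔ to from
    where
    to : IsIvs G (suc k) s → IsMinClassSize G (suc k) s
    to ((S , S-ivs , ∣S∣≡s) , ivs-minimal) =
      let c , c-proper , class≡S = isIVSSet⇒colourClass S-ivs
      in (c , c-proper , fromℕ k , trans (cong ∣_∣ class≡S) ∣S∣≡s)
       , λ c′ c′-proper i → ivs-minimal _ (colourClass-isIVSSet χ c′-proper i)

    from : IsMinClassSize G (suc k) s → IsIvs G (suc k) s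
    from ((c , c-proper , i , ∣class∣≡s) , class-minimal) =
      (colourClass c i , colourClass-isIVSSet χ c-proper i , ∣class∣≡s)
      , λ S S-ivs →
          let c′ , c′-proper , class≡S = isIVSSet⇒colourClass S-ivs
          in subst (s ≤_) (cong ∣_∣ class≡S) (class-minimal c′ c′-proper (fromℕ k))

  isMinClassSize⇒*≤ : ∀ {k s} → IsMinClassSize G k s → s * k ≤ n
  isMinClassSize⇒*≤ {k} {s} ((c , c-proper , _) , class-minimal) =
    subst₂ _≤_ (*-comm k s) (∑-∣colourClass∣ c) (*-≤-sum _ (class-minimal c c-proper))

mainTheorem2 : ∀ n (G : FinGraph (suc n)) (k : ℕ) → IsChromaticNumber G k →
    (∀ s → IsIvs G k s ⇔ IsMinClassSize G k s)
    × (∀ s → IsIvs G k s → s * k ≤ suc n)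
mainTheorem2 n G zero ((c , _) , _) with c zero
... | ()
mainTheorem2 n G (suc k) χ =
  isIvs⇔isMinClassSize G χ , λ s → isMinClassSize⇒*≤ G ∘ Equivalence.to (isIvs⇔isMinClassSize G χ s)
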